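{- Let $\mathbb A=\langle\mathbf A_i,p_{ii'},I\rangle$ and $\mathbb B=\langle\mathbf B_j,q_{jj'},J\rangle$ be semilattice direct systems of Boolean algebras, let $\mathbf A=\mathcal{P}_{\!\!\!l}(\mathbb A)$ and $\mathbf B=\mathcal{P}_{\!\!\!l}(\mathbb B)$ be their P\l onka sums, and let $h:\mathbf A\to\mathbf B$ be a homomorphism. Then for every $i\in I$ there exists $j\in J$ such that (1) $h(A_i)\subseteq B_j$, and (2) the restriction $h|_{A_i}$ is a Boolean homomorphism from $\mathbf A_i$ into $\mathbf B_j$.
   Context: Boolean algebras are $\langle A,\wedge,\vee,{}',0,1\rangle$. A semilattice direct system of Boolean algebras is $\langle\mathbf A_i,p_{ii'},I\rangle$ where $I$ is a join semilattice with least element $i_0$, each $\mathbf A_i$ is a Boolean algebra, and for $i\le i'$, $p_{ii'}:\mathbf A_i\to\mathbf A_{i'}$ is a Boolean homomorphism, with $p_{ii}=\mathrm{id}$ and $p_{i'i''}\circ p_{ii'}=p_{ii''}$ for $i\le i'\le i''$. Its P\l onka sum $\mathcal{P}_{\!\!\!l}(\mathbb A)$ is the algebra of type $(\wedge,\vee,{}',0,1)$ on the disjoint union $\bigsqcup_{i\in I}A_i$ with: for $a\in A_i$, $b\in A_{i'}$ and $k=i\vee i'$, $a\wedge b=p_{ik}(a)\wedge^{\mathbf A_k}p_{i'k}(b)$ and $a\vee b=p_{ik}(a)\vee^{\mathbf A_k}p_{i'k}(b)$; $a'$ is the complement of $a$ in $\mathbf A_i$; and $0,1$ are the bounds of $\mathbf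 A_{i_0}$. A homomorphism between P\l onka sums means a map preserving $\wedge,\vee,{}',0,1$. -}

module Defs where

open import Level using (Level; _⊔_) renaming (suc to lsuc)
open import Data.Product using (Σ; _,_; proj₁; proj₂; ∃)
open import Relation.Binary.PropositionalEquality using (_≡_; subst)
open import Relation.Binary.Lattice.Structures using (IsJoinSemilattice)
open import Algebra.Lattice.Bundles using (BooleanAlgebra)

record IsBooleanHom {c₁ ℓ₁ c₂ ℓ₂ : Level}
       (A : BooleanAlgebra c₁ ℓ₁) (B : BooleanAlgebra c₂ ℓ₂)
       (f : BooleanAlgebra.Carrier A → BooleanAlgebra.Carrier B)
       : Set (c₁ ⊔ ℓ₁ ⊔ ℓ₂) where
  private
    module A = BooleanAlgebra A
    module B = BooleanAlgebra B
  field
    cong : ∀ {x y} → x A.≈ y → f x B.≈ f y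
    ∧-hom : ∀ x y → f (x A.∧ y) B.≈ (f x B.∧ f y)
    ∨-hom : ∀ x y → f (x A.∨ y) B.≈ (f x B.∨ f y)
    ¬-hom : ∀ x → f (A.¬ x) B.≈ (B.¬ f x)
    ⊥-hom : f A.⊥ B.≈ B.⊥
    ⊤-hom : f A.⊤ B.≈ B.⊤

-- The transition maps depend only on
-- the indices (the proof of i ≤ i' is irrelevant).
record SDS (ℓI c ℓ : Level) : Set (lsuc (ℓI ⊔ c ⊔ ℓ)) where
  infix 4 _≤_
  infixr 6 _∨ᵢ_
  field
    I     : Set ℓI
    _≤_   : I → I → Set ℓI
    _∨ᵢ_  : I → I → I
    isJoinSemilattice : IsJoinSemilattice _≡_ _≤_ _∨ᵢ_
    i₀    : I
    i₀-least : ∀ i → i₀ ≤ i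
    Alg   : I → BooleanAlgebra c ℓ
    p     : ∀ {i i'} → .(i ≤ i') →
            BooleanAlgebra.Carrier (Alg i) → BooleanAlgebra.Carrier (Alg i')
    p-hom : ∀ {i i'} → .(e : i ≤ i') → IsBooleanHom (Alg i) (Alg i') (p e)
    p-id  : ∀ {i} → .(e : i ≤ i) → ∀ x → BooleanAlgebra._≈_ (Alg i) (p e x) x
    p-comp : ∀ {i i' i''} → .(e₁ : i ≤ i') → .(e₂ : i' ≤ i'') → .(e₃ : i ≤ i'') →
             ∀ x → BooleanAlgebra._≈_ (Alg i'') (p e₂ (p e₁ x)) (p e₃ x)

  open IsJoinSemilattice isJoinSemilattice public
    using (x≤x∨y; y≤x∨y)

  Car : I → Set c
  Car i = BooleanAlgebra.Carrier (Alg i)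

  PŁ : Set (ℓI ⊔ c)
  PŁ = Σ I Car

  _≈ₚ_ : PŁ → PŁ → Set (ℓI ⊔ ℓ)
  (i , a) ≈ₚ (i' , b) = Σ (i ≡ i') λ e → BooleanAlgebra._≈_ (Alg i') (subst Car e a) b

  _∧ₚ_ : PŁ → PŁ → PŁ
  (i , a) ∧ₚ (i' , b) =
    (i ∨ᵢ i') , BooleanAlgebra._∧_ (Alg (i ∨ᵢ i')) (p (x≤x∨y i i') a) (p (y≤x∨y i i') b)

  _∨ₚ_ : PŁ → PŁ → PŁ
  (i , a) ∨ₚ (i' , b) =
    (i ∨ᵢ i') , BooleanAlgebra._∨_ (Alg (i ∨ᵢ i')) (p (x≤x∨y i i') a) (p (y≤x∨y i i') b)

  ¬ₚ_ : PŁ → PŁ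
  ¬ₚ (i , a) = i , BooleanAlgebra.¬_ (Alg i) a

  0ₚ : PŁ
  0ₚ = i₀ , BooleanAlgebra.⊥ (Alg i₀)

  1ₚ : PŁ
  1ₚ = i₀ , BooleanAlgebra.⊤ (Alg i₀)

record IsPlonkaHom {ℓI c ℓ ℓJ d m : Level} (𝔸 : SDS ℓI c ℓ) (𝔹 : SDS ℓJ d m)
       (h : SDS.PŁ 𝔸 → SDS.PŁ 𝔹) : Set (ℓI ⊔ c ⊔ ℓ ⊔ ℓJ ⊔ m) where
  private
    module 𝔸 = SDS 𝔸
    module 𝔹 = SDS 𝔹
  field
    cong  : ∀ {x y} → x 𝔸.≈ₚ y → h x 𝔹.≈ₚ h y
    ∧-hom : ∀ x y → h (x 𝔸.∧ₚ y) 𝔹.≈ₚ (h x 𝔹.∧ₚ h y)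
    ∨-hom : ∀ x y → h (x 𝔸.∨ₚ y) 𝔹.≈ₚ (h x 𝔹.∨ₚ h y)
    ¬-hom : ∀ x → h (𝔸.¬ₚ x) 𝔹.≈ₚ (𝔹.¬ₚ h x)
    0-hom : h 𝔸.0ₚ 𝔹.≈ₚ 𝔹.0ₚ
    1-hom : h 𝔸.1ₚ 𝔹.≈ₚ 𝔹.1ₚ

module Submission where

open import Defs
open import Level using (Level; _⊔_)
open import Data.Product using (Σ; _×_; _,_; proj₁; proj₂)
open import Relation.Binary.Bundles using (Setoid)
open import Relation.Binary.PropositionalEquality using (_≡_; refl; sym; cong; subst; module ≡-Reasoning)
open import Relation.Binary.Lattice.Structures using (IsJoinSemilattice)
open import Algebra.Lattice.Bundles using (BooleanAlgebra)
open import Algebra.Definitions using (Congruent₂)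
import Relation.Binary.Reasoning.Setoid as SetoidReasoning
import Relation.Binary.Lattice.Properties.JoinSemilattice as JoinSemilatticeProperties

-- Write ι x for the index proj₁ (h x).  As h preserves ∧ₚ and ∨ₚ, ι turns both into
-- the join of J, and ι respects the equality of the Płonka sum.  For a, b in A_i
-- absorption a = a ∧ (a ∨ b) gives ι a = ι a ∨ (ι a ∨ ι b) ≥ ι b, so by symmetry ι
-- is constant, say j, on A_i.  Inside the single summand B_j the operations of the
-- Płonka sum are those of B_j, so h is a Boolean homomorphism from A_i to B_j.

module _ {c₁ ℓ₁ c₂ ℓ₂} (A : BooleanAlgebra c₁ ℓ₁) (B : BooleanAlgebra c₂ ℓ₂) where
  private
    module A = BooleanAlgebra A
    module B = BooleanAlgebra B

  mkIsBooleanHom : (f : A.Carrier → B.Carrier) →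
    (∀ {x y} → x A.≈ y → f x B.≈ f y) →
    (∀ x y → f (x A.∧ y) B.≈ (f x B.∧ f y)) →
    (∀ x y → f (x A.∨ y) B.≈ (f x B.∨ f y)) →
    (∀ x → f (A.¬ x) B.≈ (B.¬ f x)) →
    IsBooleanHom A B f
  mkIsBooleanHom f f-cong f-∧ f-∨ f-¬ = record
    { cong = f-cong ; ∧-hom = f-∧ ; ∨-hom = f-∨ ; ¬-hom = f-¬ ; ⊥-hom = f-⊥ ; ⊤-hom = f-⊤ }
    where
    open SetoidReasoning B.setoid

    f-⊥ : f A.⊥ B.≈ B.⊥
    f-⊥ = begin
      f A.⊥                  ≈⟨ f-cong (A.∧-complementʳ A.⊤) ⟨
      f (A.⊤ A.∧ A.¬ A.⊤)     ≈⟨ f-∧ A.⊤ (A.¬ A.⊤) ⟩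
      f A.⊤ B.∧ f (A.¬ A.⊤)   ≈⟨ B.∧-congˡ (f-¬ A.⊤) ⟩
      f A.⊤ B.∧ B.¬ f A.⊤     ≈⟨ B.∧-complementʳ (f A.⊤) ⟩
      B.⊥                    ∎

    f-⊤ : f A.⊤ B.≈ B.⊤
    f-⊤ = begin
      f A.⊤                  ≈⟨ f-cong (A.∨-complementʳ A.⊤) ⟨
      f (A.⊤ A.∨ A.¬ A.⊤)     ≈⟨ f-∨ A.⊤ (A.¬ A.⊤) ⟩
      f A.⊤ B.∨ f (A.¬ A.⊤)   ≈⟨ B.∨-congˡ (f-¬ A.⊤) ⟩
      f A.⊤ B.∨ B.¬ f A.⊤     ≈⟨ B.∨-complementʳ (f A.⊤) ⟩
      B.⊤                    ∎

module PlonkaSum {ℓI c ℓ : Level} (𝔸 : SDS ℓI c ℓ) where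
  open SDS 𝔸
  module 𝔄 (k : I) = BooleanAlgebra (Alg k)

  ∨ᵢ-idem : ∀ i → i ∨ᵢ i ≡ i
  ∨ᵢ-idem = JoinSemilatticeProperties.∨-idempotent
    (record { Carrier = I ; _≈_ = _≡_ ; _≤_ = _≤_ ; _∨_ = _∨ᵢ_ ; isJoinSemilattice = isJoinSemilattice })

  p-cong : ∀ {i i'} .(e : i ≤ i') {a b : Car i} → 𝔄._≈_ i a b → 𝔄._≈_ i' (p e a) (p e b)
  p-cong e = IsBooleanHom.cong (p-hom e)

  setoid : Setoid (ℓI ⊔ c) (ℓI ⊔ ℓ)
  setoid = record
    { Carrier = PŁ
    ; _≈_ = _≈ₚ_
    ; isEquivalence = record
      { refl = λ {x} → refl , 𝔄.refl (proj₁ x)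
      ; sym = λ { {i , _} (refl , a≈b) → refl , 𝔄.sym i a≈b }
      ; trans = λ { {i , _} (refl , a≈b) (refl , b≈c) → refl , 𝔄.trans i a≈b b≈c }
      }
    }

  ≈⇒≈ₚ : ∀ {i} {a b : Car i} → 𝔄._≈_ i a b → (i , a) ≈ₚ (i , b)
  ≈⇒≈ₚ a≈b = refl , a≈b

  -- Uses axiom K: the index equality i ≡ i must be refl.
  ≈ₚ⇒≈ : ∀ {i} {a b : Car i} → (i , a) ≈ₚ (i , b) → 𝔄._≈_ i a b
  ≈ₚ⇒≈ (refl , a≈b) = a≈b

  ≈ₚ-subst : ∀ {i i'} (e : i ≡ i') (a : Car i) → (i , a) ≈ₚ (i' , subst Car e a)
  ≈ₚ-subst {i} refl a = refl , 𝔄.refl i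

  ¬ₚ-cong : ∀ {x y} → x ≈ₚ y → (¬ₚ x) ≈ₚ (¬ₚ y)
  ¬ₚ-cong {i , _} (refl , a≈b) = refl , 𝔄.¬-cong i a≈b

  -- _∧ₚ_ and _∨ₚ_ are definitionally instances of _⊙ₚ_.
  module Lift (_⊙_ : ∀ {k} → Car k → Car k → Car k)
              (⊙-cong : ∀ {k} → Congruent₂ (𝔄._≈_ k) _⊙_) where

    _⊙ₚ_ : PŁ → PŁ → PŁ
    (i , a) ⊙ₚ (i' , b) = i ∨ᵢ i' , p (x≤x∨y i i') a ⊙ p (y≤x∨y i i') b

    ⊙ₚ-cong : Congruent₂ _≈ₚ_ _⊙ₚ_
    ⊙ₚ-cong {i , _} {_} {i' , _} (refl , a≈b) (refl , c≈d) =
      refl , ⊙-cong (p-cong (x≤x∨y i i') a≈b) (p-cong (y≤x∨y i i') c≈d)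

    ⊙ₚ-within : ∀ i (a b : Car i) → ((i , a) ⊙ₚ (i , b)) ≈ₚ (i , a ⊙ b)
    ⊙ₚ-within i a b = collapse (∨ᵢ-idem i) (x≤x∨y i i) (y≤x∨y i i)
      where
      collapse : ∀ {k} → k ≡ i → .(d₁ d₂ : i ≤ k) → (k , p d₁ a ⊙ p d₂ b) ≈ₚ (i , a ⊙ b)
      collapse refl d₁ d₂ = refl , ⊙-cong (p-id d₁ a) (p-id d₂ b)

  private
    module ∧Lift = Lift (λ {k} → 𝔄._∧_ k) (λ {k} → 𝔄.∧-cong k)
    module ∨Lift = Lift (λ {k} → 𝔄._∨_ k) (λ {k} → 𝔄.∨-cong k)

  ∧ₚ-cong : Congruent₂ _≈ₚ_ _∧ₚ_
  ∧ₚ-cong = ∧Lift.⊙ₚ-cong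

  ∨ₚ-cong : Congruent₂ _≈ₚ_ _∨ₚ_
  ∨ₚ-cong = ∨Lift.⊙ₚ-cong

  ∧ₚ-within : ∀ i (a b : Car i) → ((i , a) ∧ₚ (i , b)) ≈ₚ (i , 𝔄._∧_ i a b)
  ∧ₚ-within = ∧Lift.⊙ₚ-within

  ∨ₚ-within : ∀ i (a b : Car i) → ((i , a) ∨ₚ (i , b)) ≈ₚ (i , 𝔄._∨_ i a b)
  ∨ₚ-within = ∨Lift.⊙ₚ-within

  ∧ₚ-absorbs-∨ₚ-within : ∀ i (a b : Car i) → ((i , a) ∧ₚ ((i , a) ∨ₚ (i , b))) ≈ₚ (i , a)
  ∧ₚ-absorbs-∨ₚ-within i a b = begin
    (i , a) ∧ₚ ((i , a) ∨ₚ (i , b))  ≈⟨ ∧ₚ-cong (refl , 𝔄.refl i) (∨ₚ-within i a b) ⟩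
    (i , a) ∧ₚ (i , 𝔄._∨_ i a b)     ≈⟨ ∧ₚ-within i a (𝔄._∨_ i a b) ⟩
    (i , 𝔄._∧_ i a (𝔄._∨_ i a b))    ≈⟨ ≈⇒≈ₚ (𝔄.∧-absorbs-∨ i a b) ⟩
    (i , a)                          ∎
    where open SetoidReasoning setoid

module Restriction {ℓI c ℓ ℓJ d m : Level} {𝔸 : SDS ℓI c ℓ} {𝔹 : SDS ℓJ d m}
  {h : SDS.PŁ 𝔸 → SDS.PŁ 𝔹} (H : IsPlonkaHom 𝔸 𝔹 h) (i : SDS.I 𝔸) where

  module A = SDS 𝔸
  module B = SDS 𝔹
  module BI = IsJoinSemilattice B.isJoinSemilattice
  module AP = PlonkaSum 𝔸
  module BP = PlonkaSum 𝔹
  module H = IsPlonkaHom H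
  module Aᵢ = BooleanAlgebra (A.Alg i)

  index : A.Car i → B.I
  index a = proj₁ (h (i , a))

  index-absorbs : ∀ a b → index a ≡ index a B.∨ᵢ (index a B.∨ᵢ index b)
  index-absorbs a b = begin
    index a                                      ≡⟨ proj₁ (H.cong (AP.∧ₚ-absorbs-∨ₚ-within i a b)) ⟨
    proj₁ (h ((i , a) A.∧ₚ ((i , a) A.∨ₚ (i , b))))  ≡⟨ proj₁ (H.∧-hom (i , a) ((i , a) A.∨ₚ (i , b))) ⟩
    index a B.∨ᵢ proj₁ (h ((i , a) A.∨ₚ (i , b)))    ≡⟨ cong (index a B.∨ᵢ_) (proj₁ (H.∨-hom (i , a) (i , b))) ⟩
    index a B.∨ᵢ (index a B.∨ᵢ index b)            ∎
    where open ≡-Reasoning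

  index-≤ : ∀ a b → index b B.≤ index a
  index-≤ a b = BI.trans (B.y≤x∨y (index a) (index b))
    (subst (index a B.∨ᵢ index b B.≤_) (sym (index-absorbs a b))
      (B.y≤x∨y (index a) (index a B.∨ᵢ index b)))

  j : B.I
  j = index Aᵢ.⊤

  index≡j : ∀ a → index a ≡ j
  index≡j a = BI.antisym (index-≤ Aᵢ.⊤ a) (index-≤ a Aᵢ.⊤)

  restrict : A.Car i → B.Car j
  restrict a = subst B.Car (index≡j a) (proj₂ (h (i , a)))

  module Bⱼ = BooleanAlgebra (B.Alg j)
  open SetoidReasoning BP.setoid

  h≈restrict : ∀ a → h (i , a) B.≈ₚ (j , restrict a)
  h≈restrict a = BP.≈ₚ-subst (index≡j a) (proj₂ (h (i , a)))

  restrict-cong : ∀ {a b} → a Aᵢ.≈ b → restrict a Bⱼ.≈ restrict b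
  restrict-cong {a} {b} a≈b = BP.≈ₚ⇒≈ (begin
    (j , restrict a)  ≈⟨ h≈restrict a ⟨
    h (i , a)         ≈⟨ H.cong (AP.≈⇒≈ₚ a≈b) ⟩
    h (i , b)         ≈⟨ h≈restrict b ⟩
    (j , restrict b)  ∎)

  restrict-∧ : ∀ a b → restrict (a Aᵢ.∧ b) Bⱼ.≈ (restrict a Bⱼ.∧ restrict b)
  restrict-∧ a b = BP.≈ₚ⇒≈ (begin
    (j , restrict (a Aᵢ.∧ b))             ≈⟨ h≈restrict (a Aᵢ.∧ b) ⟨
    h (i , a Aᵢ.∧ b)                      ≈⟨ H.cong (AP.∧ₚ-within i a b) ⟨
    h ((i , a) A.∧ₚ (i , b))              ≈⟨ H.∧-hom (i , a) (i , b) ⟩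
    h (i , a) B.∧ₚ h (i , b)              ≈⟨ BP.∧ₚ-cong (h≈restrict a) (h≈restrict b) ⟩
    (j , restrict a) B.∧ₚ (j , restrict b) ≈⟨ BP.∧ₚ-within j (restrict a) (restrict b) ⟩
    (j , restrict a Bⱼ.∧ restrict b)       ∎)

  restrict-∨ : ∀ a b → restrict (a Aᵢ.∨ b) Bⱼ.≈ (restrict a Bⱼ.∨ restrict b)
  restrict-∨ a b = BP.≈ₚ⇒≈ (begin
    (j , restrict (a Aᵢ.∨ b))             ≈⟨ h≈restrict (a Aᵢ.∨ b) ⟨
    h (i , a Aᵢ.∨ b)                      ≈⟨ H.cong (AP.∨ₚ-within i a b) ⟨
    h ((i , a) A.∨ₚ (i , b))              ≈⟨ H.∨-hom (i , a) (i , b) ⟩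
    h (i , a) B.∨ₚ h (i , b)              ≈⟨ BP.∨ₚ-cong (h≈restrict a) (h≈restrict b) ⟩
    (j , restrict a) B.∨ₚ (j , restrict b) ≈⟨ BP.∨ₚ-within j (restrict a) (restrict b) ⟩
    (j , restrict a Bⱼ.∨ restrict b)       ∎)

  restrict-¬ : ∀ a → restrict (Aᵢ.¬ a) Bⱼ.≈ (Bⱼ.¬ restrict a)
  restrict-¬ a = BP.≈ₚ⇒≈ (begin
    (j , restrict (Aᵢ.¬ a))  ≈⟨ h≈restrict (Aᵢ.¬ a) ⟨
    h (A.¬ₚ (i , a))         ≈⟨ H.¬-hom (i , a) ⟩
    B.¬ₚ (h (i , a))         ≈⟨ BP.¬ₚ-cong (h≈restrict a) ⟩
    (j , Bⱼ.¬ restrict a)    ∎)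

  restrict-isBooleanHom : IsBooleanHom (A.Alg i) (B.Alg j) restrict
  restrict-isBooleanHom = mkIsBooleanHom (A.Alg i) (B.Alg j) restrict
    restrict-cong restrict-∧ restrict-∨ restrict-¬

lemma4p3 : {ℓI c ℓ ℓJ d m : Level} (𝔸 : SDS ℓI c ℓ) (𝔹 : SDS ℓJ d m)
           (h : SDS.PŁ 𝔸 → SDS.PŁ 𝔹) → IsPlonkaHom 𝔸 𝔹 h →
           (i : SDS.I 𝔸) →
           Σ (SDS.I 𝔹) λ j →
             ((a : SDS.Car 𝔸 i) → proj₁ (h (i , a)) ≡ j)
             × Σ (SDS.Car 𝔸 i → SDS.Car 𝔹 j) λ f →
                 ((a : SDS.Car 𝔸 i) → SDS._≈ₚ_ 𝔹 (h (i , a)) (j , f a))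
                 × IsBooleanHom (SDS.Alg 𝔸 i) (SDS.Alg 𝔹 j) f
lemma4p3 𝔸 𝔹 h H i = j , index≡j , restrict , h≈restrict , restrict-isBooleanHom
  where open Restriction H i
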